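{- Let $G=([m]\cup[n],E)$ be a domination graph and let $\varphi:\{0,1\}^m\to\mathcal{B}(n,w)$ be a $G$-dominating injective map. Fix a left vertex $i\in[m]$, let $\delta=\deg(i)$, and let $G'$ be the induced subgraph of $G$ obtained by removing $i$ and all $\delta$ right vertices adjacent to $i$, with its left vertices relabeled order-preservingly as $[m-1]$ and its right vertices relabeled order-preservingly as $[n-\delta]$. Then $G'$ is a domination graph and there exists a $G'$-dominating injective map $\varphi':\{0,1\}^{m-1}\to\mathcal{B}(n-\delta,w)$ (obtained from $\varphi$ by restricting to inputs with $x_i=0$ and deleting the coordinates adjacent to $i$).
   Context: For $y \in \{0,1\}^n$, $\mathrm{wt}(y)$ is the number of nonzero coordinates, and $\mathcal{B}(n,w)=\{y\in\{0,1\}^n : \mathrm{wt}(y)\le w\}$. A domination graph is a bipartite graph $G=([m]\cup[n],E)$ with left vertex set $[m]$ and right vertex set $[n]$ having no isolated right vertices. An injective map $\varphi:\{0,1\}^m\to\mathcal{B}(n,w)$ is $G$-dominating if for every $x\in\{0,1\}^m$ and every edge $(i,j)\in E$ ($i\in[m]$, $j\in[n]$): $x_i=0$ implies that the $j$-th coordinate of $\varphi(x)$ is $0$. -}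

module Defs where

open import Data.Bool using (Bool; true; false)
open import Data.Nat using (ℕ; zero; suc; _∸_; _≤_; z≤n; s≤s)
open import Data.Nat.Properties using (+-∸-assoc; m≤n⇒m≤1+n)
open import Data.Fin using (Fin; zero; suc; punchIn; cast)
open import Data.Vec using (Vec; []; _∷_; lookup; tabulate)
open import Data.Product using (∃; _×_)
open import Function.Definitions using (Injective)
open import Relation.Binary.PropositionalEquality using (_≡_; refl; sym; cong)

BGraph : ℕ → ℕ → Set
BGraph m n = Fin m → Fin n → Bool

IsDominationGraph : ∀ {m n} → BGraph m n → Set
IsDominationGraph {m} {n} E = ∀ (j : Fin n) → ∃ λ (i : Fin m) → E i j ≡ true

wt : ∀ {n} → Vec Bool n → ℕ
wt []          = 0
wt (true ∷ v)  = suc (wt v)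
wt (false ∷ v) = wt v

IsDominating : ∀ {m n} → BGraph m n → ℕ → (Vec Bool m → Vec Bool n) → Set
IsDominating E w φ =
  (∀ x → wt (φ x) ≤ w) ×
  Injective _≡_ _≡_ φ ×
  (∀ x i j → E i j ≡ true → lookup x i ≡ false → lookup (φ x) j ≡ false)

deg : ∀ {m n} → BGraph m n → Fin m → ℕ
deg E i = wt (tabulate (E i))

zc : ∀ {n} → Vec Bool n → ℕ
zc []          = 0
zc (true ∷ v)  = zc v
zc (false ∷ v) = suc (zc v)

wt≤ : ∀ {n} (v : Vec Bool n) → wt v ≤ n
wt≤ []          = z≤n
wt≤ (true ∷ v)  = s≤s (wt≤ v)
wt≤ (false ∷ v) = m≤n⇒m≤1+n (wt≤ v)

zc≡ : ∀ {n} (v : Vec Bool n) → n ∸ wt v ≡ zc v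
zc≡ []          = refl
zc≡ (true ∷ v)  = zc≡ v
zc≡ {suc n} (false ∷ v) rewrite +-∸-assoc 1 (wt≤ v) = cong suc (zc≡ v)

zeroPos : ∀ {n} (v : Vec Bool n) → Fin (zc v) → Fin n
zeroPos (true ∷ v)  k       = suc (zeroPos v k)
zeroPos (false ∷ v) zero    = zero
zeroPos (false ∷ v) (suc k) = suc (zeroPos v k)

-- order-preserving relabeling [n - deg i] → right vertices not adjacent to i
rightRelabel : ∀ {m n} (E : BGraph m n) (i : Fin m) → Fin (n ∸ deg E i) → Fin n
rightRelabel E i k = zeroPos (tabulate (E i)) (cast (zc≡ (tabulate (E i))) k)

removeVertex : ∀ {m n} (E : BGraph (suc m) n) (i : Fin (suc m)) →
               BGraph m (n ∸ deg E i)
removeVertex E i a b = E (punchIn i a) (rightRelabel E i b)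

module Submission where

-- Restrict φ to the inputs with x_i = 0, i.e. to x ↦ φ (insertAt x i false),
-- and read off only the coordinates not adjacent to i.  Domination forces every
-- such output to vanish on the neighbours of i, so no information is lost by
-- dropping those coordinates: injectivity survives.  Dropping coordinates cannot
-- raise the weight, and the domination constraints of G′ are instances of those
-- of G.  Every right vertex of G′ is dominated in G by some left vertex, which
-- cannot be i (it is not adjacent to i), so it survives in G′.

open import Defs
open import Data.Bool using (Bool; true; false)
open import Data.Nat using (ℕ; suc; _∸_; _≤_; z≤n; s≤s)
open import Data.Nat.Properties using (≤-trans; m≤n⇒m≤1+n)
open import Data.Fin using (Fin; zero; suc; punchIn; punchOut; cast)
open import Data.Fin.Properties using (cast-is-id; cast-involutive; punchIn-punchOut)
open import Data.Vec using (Vec; []; _∷_; lookup; tabulate; insertAt; removeAt)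
open import Data.Vec.Properties
  using (lookup∘tabulate; tabulate∘lookup; tabulate-cong; insertAt-lookup; insertAt-punchIn; removeAt-insertAt)
open import Data.Product using (∃; _×_; _,_)
open import Function.Definitions using (Injective)
open import Relation.Binary.PropositionalEquality
open ≡-Reasoning

vec-ext : ∀ {A : Set} {n} {u u′ : Vec A n} → (∀ j → lookup u j ≡ lookup u′ j) → u ≡ u′
vec-ext {u = u} {u′} same = begin
  u                      ≡⟨ tabulate∘lookup u ⟨
  tabulate (lookup u)    ≡⟨ tabulate-cong same ⟩
  tabulate (lookup u′)   ≡⟨ tabulate∘lookup u′ ⟩
  u′                     ∎

insertAt-injective : ∀ {A : Set} {m} (i : Fin (suc m)) (b : A) →
                     Injective _≡_ _≡_ (λ (x : Vec A m) → insertAt x i b)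
insertAt-injective i b {x} {y} eq = begin
  x                           ≡⟨ removeAt-insertAt x i b ⟨
  removeAt (insertAt x i b) i ≡⟨ cong (λ z → removeAt z i) eq ⟩
  removeAt (insertAt y i b) i ≡⟨ removeAt-insertAt y i b ⟩
  y                           ∎

zeroPos-false : ∀ {n} (v : Vec Bool n) k → lookup v (zeroPos v k) ≡ false
zeroPos-false (true ∷ v)  k       = zeroPos-false v k
zeroPos-false (false ∷ v) zero    = refl
zeroPos-false (false ∷ v) (suc k) = zeroPos-false v k

zeroPos-onto : ∀ {n} (v : Vec Bool n) j → lookup v j ≡ false → ∃ λ k → zeroPos v k ≡ j
zeroPos-onto (true ∷ v)  zero    ()
zeroPos-onto (true ∷ v)  (suc j) v[j]≡false with zeroPos-onto v j v[j]≡false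
... | k , hit = k , cong suc hit
zeroPos-onto (false ∷ v) zero    _ = zero , refl
zeroPos-onto (false ∷ v) (suc j) v[j]≡false with zeroPos-onto v j v[j]≡false
... | k , hit = suc k , cong suc hit

wt-select : ∀ {n} (u v : Vec Bool n) → wt (tabulate (λ k → lookup u (zeroPos v k))) ≤ wt u
wt-select []          []          = z≤n
wt-select (true ∷ u)  (true ∷ v)  = m≤n⇒m≤1+n (wt-select u v)
wt-select (false ∷ u) (true ∷ v)  = wt-select u v
wt-select (true ∷ u)  (false ∷ v) = s≤s (wt-select u v)
wt-select (false ∷ u) (false ∷ v) = wt-select u v

wt-select-cast : ∀ {n k} (u v : Vec Bool n) (p : k ≡ zc v) →
                 wt (tabulate (λ b → lookup u (zeroPos v (cast p b)))) ≤ wt u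
wt-select-cast u v refl
  rewrite tabulate-cong (λ b → cong (λ c → lookup u (zeroPos v c)) (cast-is-id refl b))
  = wt-select u v

module _ {m n} (E : BGraph m n) (i : Fin m) where

  private
    row : Vec Bool n
    row = tabulate (E i)

  rightRelabel-nonadjacent : ∀ b → E i (rightRelabel E i b) ≡ false
  rightRelabel-nonadjacent b =
    trans (sym (lookup∘tabulate (E i) (rightRelabel E i b))) (zeroPos-false row _)

  rightRelabel-onto : ∀ j → E i j ≡ false → ∃ λ b → rightRelabel E i b ≡ j
  rightRelabel-onto j nonadj with zeroPos-onto row j (trans (lookup∘tabulate (E i) j) nonadj)
  ... | k , hit = cast (sym (zc≡ row)) k ,
                  trans (cong (zeroPos row) (cast-involutive (zc≡ row) (sym (zc≡ row)) k)) hit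

  restrict : Vec Bool n → Vec Bool (n ∸ deg E i)
  restrict u = tabulate (λ b → lookup u (rightRelabel E i b))

  wt-restrict : ∀ u → wt (restrict u) ≤ wt u
  wt-restrict u = wt-select-cast u row (zc≡ row)

  VanishesOnNeighbours : Vec Bool n → Set
  VanishesOnNeighbours u = ∀ j → E i j ≡ true → lookup u j ≡ false

  restrict-injective : ∀ {u u′} → VanishesOnNeighbours u → VanishesOnNeighbours u′ →
                       restrict u ≡ restrict u′ → u ≡ u′
  restrict-injective {u} {u′} vu vu′ eq = vec-ext agree
    where
    agree : ∀ j → lookup u j ≡ lookup u′ j
    agree j with E i j in adj
    ... | true  = trans (vu j adj) (sym (vu′ j adj))
    ... | false with rightRelabel-onto j adj
    ... | b , refl = begin
      lookup u (rightRelabel E i b)  ≡⟨ lookup∘tabulate _ b ⟨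
      lookup (restrict u) b          ≡⟨ cong (λ z → lookup z b) eq ⟩
      lookup (restrict u′) b         ≡⟨ lookup∘tabulate _ b ⟩
      lookup u′ (rightRelabel E i b) ∎

-- (4) Deleting a left vertex preserves being a domination graph: the vertex
-- dominating a surviving right vertex b is not i, since b is not adjacent to i.
removeVertex-domination : ∀ {m n} (E : BGraph (suc m) n) (i : Fin (suc m)) →
                          IsDominationGraph E → IsDominationGraph (removeVertex E i)
removeVertex-domination E i dom b with dom (rightRelabel E i b)
... | i′ , adj = punchOut i≢i′ , trans (cong (λ z → E z (rightRelabel E i b)) (punchIn-punchOut i≢i′)) adj
  where
  i≢i′ : i ≢ i′
  i≢i′ i≡i′ with trans (sym (rightRelabel-nonadjacent E i b))
                       (trans (cong (λ z → E z (rightRelabel E i b)) i≡i′) adj)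
  ... | ()

restrictMap : ∀ {m n} (E : BGraph (suc m) n) (i : Fin (suc m)) →
              (Vec Bool (suc m) → Vec Bool n) → Vec Bool m → Vec Bool (n ∸ deg E i)
restrictMap E i φ x = restrict E i (φ (insertAt x i false))

restrictMap-dominating : ∀ {m n w} (E : BGraph (suc m) n) (i : Fin (suc m))
                         (φ : Vec Bool (suc m) → Vec Bool n) → IsDominating E w φ →
                         IsDominating (removeVertex E i) w (restrictMap E i φ)
restrictMap-dominating {m} {w = w} E i φ (wt-φ , inj-φ , dom-φ) = weight , injective , dominating
  where
  ins : Vec Bool m → Vec Bool (suc m)
  ins x = insertAt x i false

  -- φ (ins x) vanishes on the neighbours of i because x_i = 0.
  vanishes : ∀ x → VanishesOnNeighbours E i (φ (ins x))
  vanishes x j adj = dom-φ (ins x) i j adj (insertAt-lookup x i false)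

  weight : ∀ x → wt (restrictMap E i φ x) ≤ w
  weight x = ≤-trans (wt-restrict E i (φ (ins x))) (wt-φ (ins x))

  injective : Injective _≡_ _≡_ (restrictMap E i φ)
  injective {x} {y} eq =
    insertAt-injective i false (inj-φ (restrict-injective E i (vanishes x) (vanishes y) eq))

  dominating : ∀ x a b → removeVertex E i a b ≡ true → lookup x a ≡ false →
               lookup (restrictMap E i φ x) b ≡ false
  dominating x a b adj x[a]≡false = trans (lookup∘tabulate _ b)
    (dom-φ (ins x) (punchIn i a) (rightRelabel E i b) adj
           (trans (insertAt-punchIn x i false a) x[a]≡false))

lemma4 : ∀ {m n w : ℕ} (E : BGraph (suc m) n) → IsDominationGraph E →
         (φ : Vec Bool (suc m) → Vec Bool n) → IsDominating E w φ →
         (i : Fin (suc m)) →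
         IsDominationGraph (removeVertex E i) ×
         ∃ λ (φ′ : Vec Bool m → Vec Bool (n ∸ deg E i)) →
           IsDominating (removeVertex E i) w φ′
lemma4 E dom φ φ-dominating i =
  removeVertex-domination E i dom ,
  restrictMap E i φ , restrictMap-dominating E i φ φ-dominating
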